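{- Let $a\in\mathbb{YF}$, $k\in\mathbb{N}_0$ with $d(a)\ge k$, and let $1\le i_1<i_2<\dots<i_{d(a)-k}\le d(a)$ be integers. Let $d(2^k,a,i)$ denote the number of sequences $a=y_0,y_1,\dots,y_r=2^k$ ($r=|a|-2k$), with $y_j$ covering $y_{j+1}$ for all $j$, along which exactly those letters $2$ of $a$ that are the $i_1$-th, $i_2$-th, $\dots$, $i_{d(a)-k}$-th $2$ of $a$ counted from the right are removed (i.e. the remaining $k$ letters $2$ of $a$ are never changed and form the final word $2^k$). Then $$d(2^k,a,i)=\prod_{j=1}^{d(a)-k}\bigl(g'(a,i_j)+2j-2\bigr),$$ where $g'(a,t)=g(a,t)-2t+2$.
   Context: Words are finite words over $\{1,2\}$; $|x|$ is the digit sum and $d(x)$ (single argument) the number of $2$'s of $x$; $2^k$ is the word of $k$ letters $2$. $\mathbb{YF}$ is the set of all finite words. A word $y$ covers $x$ if $y$ is obtained from $x$ by replacing the leftmost $1$ of $x$ by $2$, or by inserting a $1$ somewhere to the left of the leftmost $1$ of $x$ (anywhere if $x$ has no $1$); so a downward step either deletes a $1$ that has only $2$'s to its left, or replaces the leftmost... i.e. it is the inverse of one of these two operations. For $1\le t\le d(x)$, $g(x,t)=1+$ (digit sum of the part of $x$ strictly to the right of the $t$-th letter $2$ of $x$, counting $2$'s from the right). An empty product equals $1$. -}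

module Defs where

open import Data.Nat using (ℕ; zero; suc; _+_; _*_; _∸_; _≡ᵇ_)
open import Data.Bool using (Bool; true; false; not; _∨_; if_then_else_)
open import Data.List using (List; []; _∷_; _++_)
open import Data.List.Relation.Unary.All using (All)
open import Data.Product using (_×_; _,_; Σ; ∃-syntax; proj₁)
open import Data.Sum using (_⊎_)
open import Relation.Binary.PropositionalEquality using (_≡_)

data Letter : Set where
  one two : Letter

Word : Set
Word = List Letter

∣_∣ʷ : Word → ℕ
∣ [] ∣ʷ = 0
∣ one ∷ xs ∣ʷ = 1 + ∣ xs ∣ʷ
∣ two ∷ xs ∣ʷ = 2 + ∣ xs ∣ʷ

d : Word → ℕ
d [] = 0
d (one ∷ xs) = d xs
d (two ∷ xs) = suc (d xs)

rightOf : Word → ℕ → Word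
rightOf [] t = []
rightOf (one ∷ xs) t = rightOf xs t
rightOf (two ∷ xs) t = if suc (d xs) ≡ᵇ t then xs else rightOf xs t

g : Word → ℕ → ℕ
g x t = 1 + ∣ rightOf x t ∣ʷ

-- g'(x,t) = g(x,t) - 2t + 2   (always ≥ 1 for 1 ≤ t ≤ d(x), so truncated
-- subtraction is harmless)
g′ : Word → ℕ → ℕ
g′ x t = (g x t + 2) ∸ 2 * t

data IsTwo : Letter → Set where
  isTwo : IsTwo two

-- Covering relation of the Young–Fibonacci lattice: Covers y x  means  y covers x.
data Covers : Word → Word → Set where
  replace : (pre post : Word) → All IsTwo pre →
            Covers (pre ++ two ∷ post) (pre ++ one ∷ post)
  insert  : (pre post : Word) → All IsTwo pre →
            Covers (pre ++ one ∷ post) (pre ++ post)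

-- Words whose letters carry an identity tag tracking them along a chain.
-- The Bool tag of a letter of a is  true  iff it is one of the k letters 2 of a
-- that must survive (never be changed); all other letters carry  false.
TWord : Set
TWord = List (Letter × Bool)

data TCovers : TWord → TWord → Set where
  replace : (pre post : TWord) (b : Bool) → All (λ p → IsTwo (proj₁ p)) pre →
            TCovers (pre ++ (two , b) ∷ post) (pre ++ (one , b) ∷ post)
  insert  : (pre post : TWord) (b : Bool) → All (λ p → IsTwo (proj₁ p)) pre →
            TCovers (pre ++ (one , b) ∷ post) (pre ++ post)

data Chain : TWord → TWord → Set where
  done : ∀ {x} → Chain x x
  step : ∀ {y z x} → TCovers y z → Chain z x → Chain y x

_∈ᵇ_ : ℕ → List ℕ → Bool
n ∈ᵇ [] = false
n ∈ᵇ (m ∷ ms) = (n ≡ᵇ m) ∨ (n ∈ᵇ ms)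

tagW : List ℕ → Word → TWord
tagW is [] = []
tagW is (one ∷ xs) = (one , false) ∷ tagW is xs
tagW is (two ∷ xs) = (two , not (suc (d xs) ∈ᵇ is)) ∷ tagW is xs

-- ∏_{j=1}^{m} (g'(a,i_j) + 2j - 2), with j₀ = j - 1 the running offset
prodAux : Word → List ℕ → ℕ → ℕ
prodAux a [] j₀ = 1
prodAux a (t ∷ ts) j₀ = (g′ a t + 2 * j₀) * prodAux a ts (suc j₀)

prodG : Word → List ℕ → ℕ
prodG a is = prodAux a is 0

module Submission where

-- A kept 2 in front is never touched; a 1 in front must be deleted
-- first; a removed 2 in front is lowered and deleted at one of 1 + ℓ moments of a
-- chain of length ℓ from the rest, and ℓ = weight − 2·kept is the same for all such
-- chains. In the paper's indexing the j-th removed 2 has exactly i_j − j kept 2's to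
-- its right, which turns 1 + ℓ into g′(a,i_j) + 2j − 2.

open import Defs
open import Data.Nat using (ℕ; zero; suc; _+_; _*_; _∸_; _≡ᵇ_; _≤_; _<_; _≟_; z≤n; s≤s; s≤s⁻¹)
open import Data.Nat.Properties
open import Data.Bool using (Bool; true; false; not; _∨_)
open import Data.Bool.Properties using (∨-zeroʳ)
open import Data.Fin using (Fin; zero; suc)
open import Data.Fin.Properties using (*↔×)
open import Data.List using (List; []; _∷_; _∷ʳ_; length; replicate)
open import Data.List.Properties using (length-++)
open import Data.List.Relation.Unary.All as All using (All; []; _∷_)
open import Data.List.Relation.Unary.All.Properties using (∷ʳ⁻)
open import Data.List.Relation.Unary.Linked as Linked using (Linked; []; [-]; _∷_)
import Data.List.Relation.Unary.AllPairs as AllPairs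
open import Data.List.Relation.Unary.Linked.Properties using (Linked⇒AllPairs)
open import Data.Product using (Σ; _×_; _,_; proj₁; proj₂)
open import Data.Product.Function.Dependent.Propositional using (Σ-↔)
open import Data.Product.Function.NonDependent.Propositional using (_×-↔_)
open import Data.Sum using (inj₁; inj₂)
open import Function.Bundles using (_↔_; mk↔ₛ′)
open import Function.Properties.Inverse using (↔-refl; ↔-sym; ↔-trans)
open import Relation.Nullary using (¬_; contradiction)
open import Relation.Nullary.Decidable using (dec-true; dec-false)
open import Relation.Binary.PropositionalEquality
  using (_≡_; _≢_; refl; sym; trans; cong; cong₂; subst; module ≡-Reasoning)

private
  variable
    b : Bool
    w x y z T : TWord

-- TCovers with its all-2 prefix unfolded letter by letter.
data Step : TWord → TWord → Set where
  lower-head : Step ((two , b) ∷ w) ((one , b) ∷ w)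
  drop-head  : Step ((one , b) ∷ w) w
  under-two  : Step w z → Step ((two , b) ∷ w) ((two , b) ∷ z)

infixr 5 _◅_

data Steps : TWord → TWord → Set where
  done : Steps x x
  _◅_  : Step y z → Steps z x → Steps y x

len : Steps y x → ℕ
len done    = 0
len (_ ◅ c) = suc (len c)

fromTCovers : TCovers y z → Step y z
fromTCovers (replace [] post b []) = lower-head
fromTCovers (replace ((two , _) ∷ pre) post b (isTwo ∷ pre-2s)) =
  under-two (fromTCovers (replace pre post b pre-2s))
fromTCovers (insert [] post b []) = drop-head
fromTCovers (insert ((two , _) ∷ pre) post b (isTwo ∷ pre-2s)) =
  under-two (fromTCovers (insert pre post b pre-2s))

TCovers-under-two : ∀ b → TCovers y z → TCovers ((two , b) ∷ y) ((two , b) ∷ z)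
TCovers-under-two b (replace pre post b′ pre-2s) = replace ((two , b) ∷ pre) post b′ (isTwo ∷ pre-2s)
TCovers-under-two b (insert pre post b′ pre-2s)  = insert ((two , b) ∷ pre) post b′ (isTwo ∷ pre-2s)

toTCovers : Step y z → TCovers y z
toTCovers (lower-head {b} {w}) = replace [] w b []
toTCovers (drop-head {b} {w})  = insert [] w b []
toTCovers (under-two {b = b} s) = TCovers-under-two b (toTCovers s)

fromTCovers-under-two : ∀ b (c : TCovers y z) →
                        fromTCovers (TCovers-under-two b c) ≡ under-two (fromTCovers c)
fromTCovers-under-two b (replace _ _ _ _) = refl
fromTCovers-under-two b (insert _ _ _ _)  = refl

fromTCovers∘toTCovers : (s : Step y z) → fromTCovers (toTCovers s) ≡ s
fromTCovers∘toTCovers lower-head = refl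
fromTCovers∘toTCovers drop-head  = refl
fromTCovers∘toTCovers (under-two {b = b} s) =
  trans (fromTCovers-under-two b (toTCovers s)) (cong under-two (fromTCovers∘toTCovers s))

toTCovers∘fromTCovers : (c : TCovers y z) → toTCovers (fromTCovers c) ≡ c
toTCovers∘fromTCovers (replace [] post b []) = refl
toTCovers∘fromTCovers (replace ((two , b′) ∷ pre) post b (isTwo ∷ pre-2s)) =
  cong (TCovers-under-two b′) (toTCovers∘fromTCovers (replace pre post b pre-2s))
toTCovers∘fromTCovers (insert [] post b []) = refl
toTCovers∘fromTCovers (insert ((two , b′) ∷ pre) post b (isTwo ∷ pre-2s)) =
  cong (TCovers-under-two b′) (toTCovers∘fromTCovers (insert pre post b pre-2s))

toChain : Steps y x → Chain y x
toChain done    = done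
toChain (s ◅ c) = step (toTCovers s) (toChain c)

fromChain : Chain y x → Steps y x
fromChain done       = done
fromChain (step s c) = fromTCovers s ◅ fromChain c

Steps↔Chain : Steps y x ↔ Chain y x
Steps↔Chain = mk↔ₛ′ toChain fromChain to∘from from∘to
  where
  to∘from : (c : Chain y x) → toChain (fromChain c) ≡ c
  to∘from done       = refl
  to∘from (step s c) = cong₂ step (toTCovers∘fromTCovers s) (to∘from c)
  from∘to : (c : Steps y x) → fromChain (toChain c) ≡ c
  from∘to done    = refl
  from∘to (s ◅ c) = cong₂ _◅_ (fromTCovers∘toTCovers s) (from∘to c)

weight : TWord → ℕ
weight []              = 0
weight ((one , _) ∷ w) = 1 + weight w
weight ((two , _) ∷ w) = 2 + weight w

kept : TWord → ℕ
kept []              = 0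
kept ((_ , true) ∷ w)  = suc (kept w)
kept ((_ , false) ∷ w) = kept w

AllKept : TWord → Set
AllKept = All (λ p → proj₂ p ≡ true)

twos : ℕ → TWord
twos k = replicate k (two , true)

weight-Step : Step y z → weight y ≡ suc (weight z)
weight-Step lower-head    = refl
weight-Step drop-head     = refl
weight-Step (under-two s) = cong (2 +_) (weight-Step s)

len+weight : (c : Steps y x) → len c + weight x ≡ weight y
len+weight done    = refl
len+weight (s ◅ c) = trans (cong suc (len+weight c)) (sym (weight-Step s))

len≡weight∸weight : (c : Steps y x) → len c ≡ weight y ∸ weight x
len≡weight∸weight {x = x} c =
  trans (sym (m+n∸n≡m (len c) (weight x))) (cong (_∸ weight x) (len+weight c))

kept-Step : Step y z → kept z ≤ kept y
kept-Step (lower-head {true})  = ≤-refl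
kept-Step (lower-head {false}) = ≤-refl
kept-Step (drop-head {true})   = n≤1+n _
kept-Step (drop-head {false})  = ≤-refl
kept-Step (under-two {b = true} s)  = s≤s (kept-Step s)
kept-Step (under-two {b = false} s) = kept-Step s

kept-Steps : Steps y x → kept x ≤ kept y
kept-Steps done    = ≤-refl
kept-Steps (s ◅ c) = ≤-trans (kept-Steps c) (kept-Step s)

weight-twos : ∀ k → weight (twos k) ≡ 2 * k
weight-twos zero    = refl
weight-twos (suc k) = trans (cong (2 +_) (weight-twos k)) (sym (*-suc 2 k))

kept-twos : ∀ k → kept (twos k) ≡ k
kept-twos zero    = refl
kept-twos (suc k) = cong suc (kept-twos k)

kept≤kept-twos : ∀ w → kept w ≤ kept (twos (kept w))
kept≤kept-twos w = ≤-reflexive (sym (kept-twos (kept w)))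

AllKept-twos : ∀ k → AllKept (twos k)
AllKept-twos zero    = []
AllKept-twos (suc k) = refl ∷ AllKept-twos k

¬AllKept-false : ∀ {l} → ¬ AllKept ((l , false) ∷ w)
¬AllKept-false (() ∷ _)

¬Steps-one-true : kept w ≤ kept T → ¬ Steps ((one , true) ∷ w) ((two , true) ∷ T)
¬Steps-one-true w≤T (drop-head ◅ c) = 1+n≰n (≤-trans (kept-Steps c) w≤T)

Steps-two-true : kept w ≤ kept T → Steps w T ↔ Steps ((two , true) ∷ w) ((two , true) ∷ T)
Steps-two-true w≤T = mk↔ₛ′ lift (unlift w≤T) (lift∘unlift w≤T) (unlift∘lift w≤T)
  where
  lift : Steps w T → Steps ((two , true) ∷ w) ((two , true) ∷ T)
  lift done    = done
  lift (s ◅ c) = under-two s ◅ lift c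
  unlift : kept w ≤ kept T → Steps ((two , true) ∷ w) ((two , true) ∷ T) → Steps w T
  unlift w≤T done              = done
  unlift w≤T (lower-head ◅ c)  = contradiction c (¬Steps-one-true w≤T)
  unlift w≤T (under-two s ◅ c) = s ◅ unlift (≤-trans (kept-Step s) w≤T) c
  lift∘unlift : (w≤T : kept w ≤ kept T) (c : Steps ((two , true) ∷ w) ((two , true) ∷ T)) →
                lift (unlift w≤T c) ≡ c
  lift∘unlift w≤T done              = refl
  lift∘unlift w≤T (lower-head ◅ c)  = contradiction c (¬Steps-one-true w≤T)
  lift∘unlift w≤T (under-two s ◅ c) = cong (under-two s ◅_) (lift∘unlift _ c)
  unlift∘lift : (w≤T : kept w ≤ kept T) (c : Steps w T) → unlift w≤T (lift c) ≡ c
  unlift∘lift w≤T done    = refl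
  unlift∘lift w≤T (s ◅ c) = cong (s ◅_) (unlift∘lift _ c)

module _ (T-kept : AllKept T) where

  Steps-one-false : Steps ((one , false) ∷ w) T ↔ Steps w T
  Steps-one-false = mk↔ₛ′ tail (drop-head ◅_) (λ _ → refl) drop∘tail
    where
    tail : Steps ((one , false) ∷ w) T → Steps w T
    tail done             = contradiction T-kept ¬AllKept-false
    tail (drop-head ◅ c)  = c
    drop∘tail : (c : Steps ((one , false) ∷ w) T) → drop-head ◅ tail c ≡ c
    drop∘tail done            = contradiction T-kept ¬AllKept-false
    drop∘tail (drop-head ◅ c) = refl

  -- A chain that removes the head 2 runs some prefix of a chain from w below the head,
  -- then lowers the head and deletes it at once; the Fin is the length of that prefix.
  Steps-two-false : Σ (Steps w T) (λ c → Fin (suc (len c))) ↔ Steps ((two , false) ∷ w) T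
  Steps-two-false = mk↔ₛ′ (λ (c , i) → insertAt c i) split insertAt∘split split∘insertAt
    where
    insertAt : (c : Steps w T) → Fin (suc (len c)) → Steps ((two , false) ∷ w) T
    insertAt c       zero    = lower-head ◅ drop-head ◅ c
    insertAt (s ◅ c) (suc i) = under-two s ◅ insertAt c i
    split : Steps ((two , false) ∷ w) T → Σ (Steps w T) (λ c → Fin (suc (len c)))
    split done                         = contradiction T-kept ¬AllKept-false
    split (lower-head ◅ done)          = contradiction T-kept ¬AllKept-false
    split (lower-head ◅ drop-head ◅ c) = c , zero
    split (under-two s ◅ c) with split c
    ... | c′ , i = s ◅ c′ , suc i
    insertAt∘split : (c : Steps ((two , false) ∷ w) T) → insertAt (proj₁ (split c)) (proj₂ (split c)) ≡ c
    insertAt∘split done                         = contradiction T-kept ¬AllKept-false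
    insertAt∘split (lower-head ◅ done)          = contradiction T-kept ¬AllKept-false
    insertAt∘split (lower-head ◅ drop-head ◅ c) = refl
    insertAt∘split (under-two s ◅ c)            = cong (under-two s ◅_) (insertAt∘split c)
    split∘insertAt : ((c , i) : Σ (Steps w T) (λ c → Fin (suc (len c)))) → split (insertAt c i) ≡ (c , i)
    split∘insertAt (c , zero)        = refl
    split∘insertAt (s ◅ c , suc i) rewrite split∘insertAt (c , i) = refl

Fin-cong : ∀ {m n} → m ≡ n → Fin m ↔ Fin n
Fin-cong refl = ↔-refl

-- Every chain from w to twos (kept w) has length weight w ∸ 2 * kept w.
chainCount : TWord → ℕ
chainCount []                  = 1
chainCount ((one , false) ∷ w) = chainCount w
chainCount ((one , true) ∷ w)  = 0
chainCount ((two , true) ∷ w)  = chainCount w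
chainCount ((two , false) ∷ w) = chainCount w * suc (weight w ∸ 2 * kept w)

Fin-chainCount↔Steps : ∀ w → Fin (chainCount w) ↔ Steps w (twos (kept w))
Fin-chainCount↔Steps [] = mk↔ₛ′ (λ _ → done) (λ _ → zero) unique-done unique-zero
  where
  unique-done : (c : Steps [] []) → done ≡ c
  unique-done done = refl
  unique-zero : (i : Fin 1) → zero ≡ i
  unique-zero zero = refl
Fin-chainCount↔Steps ((one , false) ∷ w) =
  ↔-trans (Fin-chainCount↔Steps w) (↔-sym (Steps-one-false (AllKept-twos (kept w))))
Fin-chainCount↔Steps ((one , true) ∷ w) =
  mk↔ₛ′ (λ ()) (λ c → contradiction c ¬c) (λ c → contradiction c ¬c) (λ ())
  where
  ¬c : ¬ Steps ((one , true) ∷ w) (twos (suc (kept w)))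
  ¬c = ¬Steps-one-true (kept≤kept-twos w)
Fin-chainCount↔Steps ((two , true) ∷ w) =
  ↔-trans (Fin-chainCount↔Steps w) (Steps-two-true (kept≤kept-twos w))
Fin-chainCount↔Steps ((two , false) ∷ w) =
  ↔-trans *↔×
    (↔-trans (Fin-chainCount↔Steps w ×-↔ ↔-refl)
      (↔-trans (Σ-↔ ↔-refl (λ {c} → Fin-cong (cong suc (sym (len≡ c)))))
        (Steps-two-false (AllKept-twos (kept w)))))
  where
  len≡ : (c : Steps w (twos (kept w))) → len c ≡ weight w ∸ 2 * kept w
  len≡ c = trans (len≡weight∸weight c) (cong (weight w ∸_) (weight-twos (kept w)))

Fin-chainCount↔Chain : ∀ w → Fin (chainCount w) ↔ Chain w (twos (kept w))
Fin-chainCount↔Chain w = ↔-trans (Fin-chainCount↔Steps w) Steps↔Chain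

Indices : ℕ → List ℕ → Set
Indices m is = Linked _<_ is × All (λ t → 1 ≤ t × t ≤ m) is

data TopSplit (m : ℕ) : List ℕ → Set where
  absent : ∀ {is} → (suc m ∈ᵇ is) ≡ false → Indices m is → TopSplit m is
  last   : ∀ {is} → Indices m is → TopSplit m (is ∷ʳ suc m)

length-∷ʳ : ∀ {A : Set} (xs : List A) {x} → length (xs ∷ʳ x) ≡ suc (length xs)
length-∷ʳ xs = trans (length-++ xs) (+-comm (length xs) 1)

Linked-∷ʳ⁻ : ∀ {A : Set} {R : A → A → Set} xs {x} → Linked R (xs ∷ʳ x) → Linked R xs
Linked-∷ʳ⁻ []           _        = []
Linked-∷ʳ⁻ (_ ∷ [])     _        = [-]
Linked-∷ʳ⁻ (_ ∷ _ ∷ xs) (r ∷ rs) = r ∷ Linked-∷ʳ⁻ (_ ∷ xs) rs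

topSplit : ∀ {m} is → Indices (suc m) is → TopSplit m is
topSplit [] _ = absent refl ([] , [])
topSplit {m} (x ∷ xs) (x∷xs↗ , (1≤x , x≤1+m) ∷ xs≤) with topSplit xs (Linked.tail x∷xs↗ , xs≤)
... | last (_ , ys≤) =
  last (Linked-∷ʳ⁻ (x ∷ _) x∷xs↗ , (1≤x , s≤s⁻¹ x<1+m) ∷ ys≤)
  where
  x<1+m : x < suc m
  x<1+m = proj₂ (∷ʳ⁻ (AllPairs.head (Linked⇒AllPairs <-trans x∷xs↗)))
... | absent 1+m∉xs (_ , xs≤m) with m≤n⇒m<n∨m≡n x≤1+m
...   | inj₁ x<1+m =
  absent (cong₂ _∨_ (dec-false (suc m ≟ x) (>⇒≢ x<1+m)) 1+m∉xs) (x∷xs↗ , (1≤x , s≤s⁻¹ x<1+m) ∷ xs≤m)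
...   | inj₂ refl with xs
...     | []    = last ([] , [])
...     | _ ∷ _ = contradiction (<-≤-trans (Linked.head x∷xs↗) (proj₂ (All.head xs≤))) (<-irrefl refl)

length-≤ : ∀ m is → Indices m is → length is ≤ m
length-≤ zero    []      _ = z≤n
length-≤ zero    (_ ∷ _) (_ , (() , z≤n) ∷ _)
length-≤ (suc m) is      ind with topSplit is ind
... | absent _ ind′ = m≤n⇒m≤1+n (length-≤ m is ind′)
... | last {is′} ind′ = ≤-trans (≤-reflexive (length-∷ʳ is′)) (s≤s (length-≤ m is′ ind′))

∈ᵇ-∷ʳ-≢ : ∀ {t n} is → t ≢ n → (t ∈ᵇ (is ∷ʳ n)) ≡ (t ∈ᵇ is)
∈ᵇ-∷ʳ-≢ {t} {n} []       t≢n = cong (_∨ false) (dec-false (t ≟ n) t≢n)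
∈ᵇ-∷ʳ-≢ {t}     (x ∷ is) t≢n = cong ((t ≡ᵇ x) ∨_) (∈ᵇ-∷ʳ-≢ is t≢n)

∈ᵇ-∷ʳ-self : ∀ {n} is → (n ∈ᵇ (is ∷ʳ n)) ≡ true
∈ᵇ-∷ʳ-self {n} []       = cong (_∨ false) (dec-true (n ≟ n) refl)
∈ᵇ-∷ʳ-self {n} (x ∷ is) = trans (cong ((n ≡ᵇ x) ∨_) (∈ᵇ-∷ʳ-self is)) (∨-zeroʳ _)

tagW-∷ʳ-above : ∀ is {n} a → d a < n → tagW (is ∷ʳ n) a ≡ tagW is a
tagW-∷ʳ-above is []         _   = refl
tagW-∷ʳ-above is (one ∷ a)  a<n = cong ((one , false) ∷_) (tagW-∷ʳ-above is a a<n)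
tagW-∷ʳ-above is (two ∷ a)  a<n =
  cong₂ (λ b w → (two , not b) ∷ w) (∈ᵇ-∷ʳ-≢ is (<⇒≢ a<n)) (tagW-∷ʳ-above is a (<⇒≤ a<n))

tagW-two-absent : ∀ {is} a → (suc (d a) ∈ᵇ is) ≡ false → tagW is (two ∷ a) ≡ (two , true) ∷ tagW is a
tagW-two-absent {is} a ∉is = cong (λ b → (two , not b) ∷ tagW is a) ∉is

tagW-two-last : ∀ is a → tagW (is ∷ʳ suc (d a)) (two ∷ a) ≡ (two , false) ∷ tagW is a
tagW-two-last is a =
  cong₂ (λ b w → (two , not b) ∷ w) (∈ᵇ-∷ʳ-self is) (tagW-∷ʳ-above is a ≤-refl)

weight-tagW : ∀ is a → weight (tagW is a) ≡ ∣ a ∣ʷ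
weight-tagW is []        = refl
weight-tagW is (one ∷ a) = cong suc (weight-tagW is a)
weight-tagW is (two ∷ a) = cong (2 +_) (weight-tagW is a)

kept-tagW : ∀ a is → Indices (d a) is → kept (tagW is a) ≡ d a ∸ length is
kept-tagW []        []      _ = refl
kept-tagW []        (_ ∷ _) (_ , (() , z≤n) ∷ _)
kept-tagW (one ∷ a) is      ind = kept-tagW a is ind
kept-tagW (two ∷ a) is      ind with topSplit is ind
... | absent ∉is ind′ = begin
  kept (tagW is (two ∷ a))   ≡⟨ cong kept (tagW-two-absent a ∉is) ⟩
  suc (kept (tagW is a))     ≡⟨ cong suc (kept-tagW a is ind′) ⟩
  suc (d a ∸ length is)      ≡⟨ sym (+-∸-assoc 1 (length-≤ (d a) is ind′)) ⟩
  suc (d a) ∸ length is      ∎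
  where open ≡-Reasoning
... | last {is′} ind′ = begin
  kept (tagW (is′ ∷ʳ suc (d a)) (two ∷ a)) ≡⟨ cong kept (tagW-two-last is′ a) ⟩
  kept (tagW is′ a)                        ≡⟨ kept-tagW a is′ ind′ ⟩
  d a ∸ length is′                         ≡⟨ cong (suc (d a) ∸_) (sym (length-∷ʳ is′)) ⟩
  suc (d a) ∸ length (is′ ∷ʳ suc (d a))    ∎
  where open ≡-Reasoning

2*d≤∣∣ʷ : ∀ a → 2 * d a ≤ ∣ a ∣ʷ
2*d≤∣∣ʷ []        = z≤n
2*d≤∣∣ʷ (one ∷ a) = m≤n⇒m≤1+n (2*d≤∣∣ʷ a)
2*d≤∣∣ʷ (two ∷ a) = ≤-trans (≤-reflexive (*-suc 2 (d a))) (s≤s (s≤s (2*d≤∣∣ʷ a)))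

rightOf-two : ∀ {a t} → t ≤ d a → rightOf (two ∷ a) t ≡ rightOf a t
rightOf-two {a} {t} t≤d rewrite dec-false (suc (d a) ≟ t) (>⇒≢ (s≤s t≤d)) = refl

rightOf-top : ∀ a → rightOf (two ∷ a) (suc (d a)) ≡ a
rightOf-top a rewrite dec-true (d a ≟ d a) refl = refl

g′-two : ∀ {a t} → t ≤ d a → g′ (two ∷ a) t ≡ g′ a t
g′-two {t = t} t≤d = cong (λ r → (1 + ∣ r ∣ʷ + 2) ∸ 2 * t) (rightOf-two t≤d)

g′-top : ∀ a → g′ (two ∷ a) (suc (d a)) ≡ suc (∣ a ∣ʷ ∸ 2 * d a)
g′-top a = begin
  (1 + ∣ rightOf (two ∷ a) (suc (d a)) ∣ʷ + 2) ∸ 2 * suc (d a)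
    ≡⟨ cong₂ (λ r m → (1 + ∣ r ∣ʷ + 2) ∸ m) (rightOf-top a) (*-suc 2 (d a)) ⟩
  (1 + ∣ a ∣ʷ + 2) ∸ (2 + 2 * d a)
    ≡⟨ cong (_∸ (2 + 2 * d a)) (+-comm (1 + ∣ a ∣ʷ) 2) ⟩
  (1 + ∣ a ∣ʷ) ∸ 2 * d a
    ≡⟨ +-∸-assoc 1 (2*d≤∣∣ʷ a) ⟩
  suc (∣ a ∣ʷ ∸ 2 * d a) ∎
  where open ≡-Reasoning

prodAux-cong : ∀ {a b} is j → All (λ t → g′ a t ≡ g′ b t) is → prodAux a is j ≡ prodAux b is j
prodAux-cong []       j []           = refl
prodAux-cong (t ∷ is) j (eq ∷ eqs) = cong₂ (λ x y → (x + 2 * j) * y) eq (prodAux-cong is (suc j) eqs)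

prodAux-two : ∀ {a} is j → All (λ t → 1 ≤ t × t ≤ d a) is → prodAux (two ∷ a) is j ≡ prodAux a is j
prodAux-two is j is≤d = prodAux-cong is j (All.map (λ (_ , t≤d) → g′-two t≤d) is≤d)

prodAux-∷ʳ : ∀ a is t j → prodAux a (is ∷ʳ t) j ≡ prodAux a is j * (g′ a t + 2 * (j + length is))
prodAux-∷ʳ a []       t j = begin
  (g′ a t + 2 * j) * 1       ≡⟨ *-identityʳ _ ⟩
  g′ a t + 2 * j             ≡⟨ cong (λ m → g′ a t + 2 * m) (sym (+-identityʳ j)) ⟩
  g′ a t + 2 * (j + 0)       ≡⟨ sym (*-identityˡ _) ⟩
  1 * (g′ a t + 2 * (j + 0)) ∎
  where open ≡-Reasoning
prodAux-∷ʳ a (x ∷ is) t j = begin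
  (g′ a x + 2 * j) * prodAux a (is ∷ʳ t) (suc j)
    ≡⟨ cong ((g′ a x + 2 * j) *_) (prodAux-∷ʳ a is t (suc j)) ⟩
  (g′ a x + 2 * j) * (prodAux a is (suc j) * (g′ a t + 2 * (suc j + length is)))
    ≡⟨ sym (*-assoc (g′ a x + 2 * j) _ _) ⟩
  prodAux a (x ∷ is) j * (g′ a t + 2 * (suc j + length is))
    ≡⟨ cong (λ m → prodAux a (x ∷ is) j * (g′ a t + 2 * m)) (sym (+-suc j (length is))) ⟩
  prodAux a (x ∷ is) j * (g′ a t + 2 * (j + suc (length is))) ∎
  where open ≡-Reasoning

top-factor : ∀ {A D l} → l ≤ D → 2 * D ≤ A → suc (A ∸ 2 * D) + 2 * l ≡ suc (A ∸ 2 * (D ∸ l))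
top-factor {A} {D} {l} l≤D 2D≤A = cong suc (begin
  A ∸ 2 * D + 2 * l                        ≡⟨ sym (+-∸-comm (2 * l) 2D≤A) ⟩
  A + 2 * l ∸ 2 * D                        ≡⟨ cong (A + 2 * l ∸_) (sym (m∸n+n≡m 2l≤2D)) ⟩
  A + 2 * l ∸ (2 * D ∸ 2 * l + 2 * l)      ≡⟨ sym (∸-+-assoc (A + 2 * l) (2 * D ∸ 2 * l) (2 * l)) ⟩
  A + 2 * l ∸ (2 * D ∸ 2 * l) ∸ 2 * l      ≡⟨ cong (_∸ 2 * l) (+-∸-comm (2 * l) 2D-2l≤A) ⟩
  A ∸ (2 * D ∸ 2 * l) + 2 * l ∸ 2 * l      ≡⟨ m+n∸n≡m _ (2 * l) ⟩
  A ∸ (2 * D ∸ 2 * l)                      ≡⟨ cong (A ∸_) (sym (*-distribˡ-∸ 2 D l)) ⟩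
  A ∸ 2 * (D ∸ l)                          ∎)
  where
  open ≡-Reasoning
  2l≤2D : 2 * l ≤ 2 * D
  2l≤2D = *-monoʳ-≤ 2 l≤D
  2D-2l≤A : 2 * D ∸ 2 * l ≤ A
  2D-2l≤A = ≤-trans (m∸n≤m (2 * D) (2 * l)) 2D≤A

chainCount-tagW : ∀ a is → Indices (d a) is → chainCount (tagW is a) ≡ prodG a is
chainCount-tagW []        []      _ = refl
chainCount-tagW []        (_ ∷ _) (_ , (() , z≤n) ∷ _)
chainCount-tagW (one ∷ a) is      ind =
  trans (chainCount-tagW a is ind) (prodAux-cong is 0 (All.universal (λ _ → refl) is))
chainCount-tagW (two ∷ a) is      ind with topSplit is ind
... | absent ∉is ind′@(_ , is≤d) = begin
  chainCount (tagW is (two ∷ a)) ≡⟨ cong chainCount (tagW-two-absent a ∉is) ⟩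
  chainCount (tagW is a)         ≡⟨ chainCount-tagW a is ind′ ⟩
  prodG a is                     ≡⟨ sym (prodAux-two is 0 is≤d) ⟩
  prodG (two ∷ a) is             ∎
  where open ≡-Reasoning
... | last {is′} ind′@(_ , is′≤d) = begin
  chainCount (tagW (is′ ∷ʳ suc (d a)) (two ∷ a))
    ≡⟨ cong chainCount (tagW-two-last is′ a) ⟩
  chainCount w′ * suc (weight w′ ∸ 2 * kept w′)
    ≡⟨ cong₂ (λ p m → p * suc m) (chainCount-tagW a is′ ind′)
             (cong₂ (λ m n → m ∸ 2 * n) (weight-tagW is′ a) (kept-tagW a is′ ind′)) ⟩
  prodG a is′ * suc (∣ a ∣ʷ ∸ 2 * (d a ∸ length is′))
    ≡⟨ cong₂ _*_ (sym (prodAux-two is′ 0 is′≤d)) factor ⟩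
  prodG (two ∷ a) is′ * (g′ (two ∷ a) (suc (d a)) + 2 * length is′)
    ≡⟨ sym (prodAux-∷ʳ (two ∷ a) is′ (suc (d a)) 0) ⟩
  prodG (two ∷ a) (is′ ∷ʳ suc (d a)) ∎
  where
  open ≡-Reasoning
  w′ : TWord
  w′ = tagW is′ a
  factor : suc (∣ a ∣ʷ ∸ 2 * (d a ∸ length is′)) ≡ g′ (two ∷ a) (suc (d a)) + 2 * length is′
  factor = sym (trans (cong (_+ 2 * length is′) (g′-top a))
                      (top-factor (length-≤ (d a) is′ ind′) (2*d≤∣∣ʷ a)))

mainTheorem9 : (a : Word) (k : ℕ) → k ≤ d a →
    (is : List ℕ) → length is ≡ d a ∸ k → Linked _<_ is →
    All (λ t → 1 ≤ t × t ≤ d a) is →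
    Fin (prodG a is) ↔ Chain (tagW is a) (replicate k (two , true))
mainTheorem9 a k k≤d is len≡ is↗ is≤d =
  ↔-trans (Fin-cong (sym (chainCount-tagW a is ind)))
    (subst (λ n → Fin _ ↔ Chain (tagW is a) (twos n)) kept≡k (Fin-chainCount↔Chain (tagW is a)))
  where
  ind : Indices (d a) is
  ind = is↗ , is≤d
  kept≡k : kept (tagW is a) ≡ k
  kept≡k = trans (kept-tagW a is ind) (trans (cong (d a ∸_) len≡) (m∸[m∸n]≡n k≤d))
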